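{- Let $T$ be a graph with distinct vertices $u_1,\dots,u_k$ for some $k\geq 1$. Let $G$ be a rooted graph with root $r$, and set $Q=PG-x\,P(G-r)$ and $R=P(G-r)$. Then for any signature $(a_1,\dots,a_k)$ of positive integers, $$P\,T(u_1\!=\!r)G^{(a_1)}\cdots(u_k\!=\!r)G^{(a_k)}=\sum_{I\subseteq\{1,\dots,k\}}P\Bigl(T-\textstyle\sum_{i\in I}u_i\Bigr)\prod_{j\in I}a_j\;Q^{|I|}\,R^{\sum_{m=1}^k a_m-|I|}.$$
   Context: For a graph $H$, $PH$ (or $P(H)$) denotes the characteristic polynomial of the adjacency matrix of $H$ in the variable $x$. For a rooted graph $G$ with root $r$ and integer $a\geq1$, $G^{(a)}$ is the graph obtained from $a$ vertex-disjoint copies of $G$ by identifying all their roots into one vertex, again called $r$. The multiple coalescence $T(u_1\!=\!r)G^{(a_1)}\cdots(u_k\!=\!r)G^{(a_k)}$ is obtained from the disjoint union of $T$ and (separate copies of) $G^{(a_1)},\dots,G^{(a_k)}$ by identifying $u_i$ with the root of the $i$-th attached graph $G^{(a_i)}$, for each $i$. $T-\sum_{i\in I}u_i$ denotes $T$ with the vertices $u_i$, $i\in I$, and their incident edges deleted; $G-r$ denotes deletion of $r$. -}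

module Defs where

open import Data.Nat as ℕ using (ℕ; zero; suc)
open import Data.Integer as ℤ using (ℤ; +_; _-_; -_)
open import Data.Bool using (Bool; true; false; if_then_else_; _∧_; _∨_; not)
open import Data.Fin using (Fin; zero; suc; toℕ; punchIn)
open import Data.Fin.Properties using (_≟_)
open import Data.Fin.Subset using (Subset; ∣_∣)
open import Data.List using (List; []; _∷_; _++_; map; foldr; concatMap; filter; length; lookup; allFin)
open import Data.Vec using (Vec; []; _∷_)
import Data.Vec as Vec
open import Data.Product using (Σ; _×_; _,_)
open import Data.Sum using (_⊎_; inj₁; inj₂)
open import Relation.Binary.PropositionalEquality using (_≡_)
open import Relation.Nullary using (does)
import Data.Nat.Properties as ℕP

record Graph (n : ℕ) : Set where
  field
    adj    : Fin n → Fin n → Bool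
    symm   : ∀ i j → adj i j ≡ adj j i
    irrefl : ∀ i → adj i i ≡ false
open Graph public

sumℤ : List ℤ → ℤ
sumℤ = foldr ℤ._+_ (+ 0)

sgn : ℕ → ℤ
sgn zero = + 1
sgn (suc k) = - sgn k

det : ∀ {n} → (Fin n → Fin n → ℤ) → ℤ
det {zero} M = + 1
det {suc n} M =
  sumℤ (map (λ j → sgn (toℕ j) ℤ.* M zero j ℤ.* det (λ i l → M (suc i) (punchIn j l))) (allFin (suc n)))

boolℤ : Bool → ℤ
boolℤ true = + 1
boolℤ false = + 0

-- Characteristic polynomial det(xI - A), evaluated at x : ℤ, of the graph with
-- adjacency relation `a` on a vertex type V induced on the (duplicate-free) list
-- of vertices vs.
charPolyOn : {V : Set} → (V → V → Bool) → List V → ℤ → ℤ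
charPolyOn a vs x =
  det (λ i j → (if does (i ≟ j) then x else + 0) - boolℤ (a (lookup vs i) (lookup vs j)))

P : ∀ {n} → Graph n → ℤ → ℤ
P {n} H = charPolyOn (adj H) (allFin n)

PminusRoot : ∀ {m} → Graph (suc m) → Fin (suc m) → ℤ → ℤ
PminusRoot {m} G r = charPolyOn (adj G) (map (punchIn r) (allFin m))

PminusSet : ∀ {n k} → Graph n → (Fin k → Fin n) → Subset k → ℤ → ℤ
PminusSet {n} {k} T u I =
  charPolyOn (adj T) (filter (λ v → Relation.Nullary.¬? (deleted v)) (allFin n))
  where
    open import Relation.Nullary using (Dec; yes; no)
    import Relation.Nullary
    open import Data.Fin.Properties using (any?)
    open import Data.Fin.Subset using (_∈_)
    open import Data.Fin.Subset.Properties using (_∈?_)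
    open import Data.Product using (∃)
    deleted : ∀ v → Dec (∃ λ i → (i ∈ I) × (u i ≡ v))
    deleted v = any? (λ i → Relation.Nullary._×-dec_ (i ∈? I) (u i ≟ v))

allSubsets : ∀ k → List (Subset k)
allSubsets zero = [] ∷ []
allSubsets (suc k) = map (false ∷_) (allSubsets k) ++ map (true ∷_) (allSubsets k)

-- Vertex type of T(u_1=r)G^(a_1)...(u_k=r)G^(a_k): the vertices of T, plus for each
-- i, each copy c < a_i of G, and each non-root vertex w of G (encoded as
-- punchIn r w), one vertex.
CoalV : ℕ → (k : ℕ) → (Fin k → ℕ) → ℕ → Set
CoalV n k a m = Fin n ⊎ Σ (Fin k) (λ i → Fin (a i) × Fin m)

coalAdj : ∀ {n k m} (T : Graph n) (u : Fin k → Fin n) (a : Fin k → ℕ)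
          (G : Graph (suc m)) (r : Fin (suc m)) →
          CoalV n k a m → CoalV n k a m → Bool
coalAdj T u a G r (inj₁ s) (inj₁ t) = adj T s t
coalAdj T u a G r (inj₁ s) (inj₂ (i , c , w)) = does (u i ≟ s) ∧ adj G r (punchIn r w)
coalAdj T u a G r (inj₂ (i , c , w)) (inj₁ s) = does (u i ≟ s) ∧ adj G (punchIn r w) r
coalAdj T u a G r (inj₂ (i , c , w)) (inj₂ (i' , c' , w')) =
  does (i ≟ i') ∧ does (toℕ c ℕP.≟ toℕ c') ∧ adj G (punchIn r w) (punchIn r w')

coalVertices : ∀ n k (a : Fin k → ℕ) m → List (CoalV n k a m)
coalVertices n k a m =
  map inj₁ (allFin n) ++
  concatMap (λ i → concatMap (λ c → map (λ w → inj₂ (i , c , w)) (allFin m)) (allFin (a i))) (allFin k)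

PCoal : ∀ {n k m} (T : Graph n) (u : Fin k → Fin n) (a : Fin k → ℕ)
        (G : Graph (suc m)) (r : Fin (suc m)) → ℤ → ℤ
PCoal {n} {k} {m} T u a G r = charPolyOn (coalAdj T u a G r) (coalVertices n k a m)

prodIn : ∀ {k} → (Fin k → ℕ) → Subset k → ℕ
prodIn {k} a I = foldr ℕ._*_ 1 (map (λ j → if Vec.lookup I j then a j else 1) (allFin k))

sumAll : ∀ {k} → (Fin k → ℕ) → ℕ
sumAll {k} a = foldr ℕ._+_ 0 (map a (allFin k))

RHS : ∀ {n k m} (T : Graph n) (u : Fin k → Fin n) (a : Fin k → ℕ)
      (G : Graph (suc m)) (r : Fin (suc m)) → ℤ → ℤ
RHS {n} {k} T u a G r x =
  sumℤ (map (λ I → PminusSet T u I x ℤ.* (+ prodIn a I) ℤ.* (Q ℤ.^ ∣ I ∣) ℤ.* (R ℤ.^ (sumAll a ℕ.∸ ∣ I ∣)))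
            (allSubsets k))
  where
    R = PminusRoot G r x
    Q = P G x - x ℤ.* R

module Submission where

-- Every attachment vertex uᵢ is a cut vertex, so Schwenk's formula
--   P(H₁ ∪ H₂) = P(H₁) P(H₂ - v) + P(H₁ - v) (P(H₂) - x P(H₂ - v))   (H₁ ∩ H₂ = {v})
-- applies with H₂ the branch G^(aᵢ) at uᵢ. Since G^(aᵢ) - r is aᵢ disjoint copies
-- of G - r, P(H₂ - v) = R^aᵢ, and Schwenk's formula at r together with induction on
-- aᵢ gives P(G^(aᵢ)) - x R^aᵢ = aᵢ Q R^(aᵢ-1). So each uᵢ either survives with
-- factor R^aᵢ or is deleted with factor aᵢ Q R^(aᵢ-1); inducting over the uᵢ yields
-- one term per set I of deleted attachment vertices.
--
-- Characteristic polynomials are handled as principal minors of xI - A, and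
-- Schwenk's formula is proved for these by Laplace expansion along the cut vertex
-- together with block triangularity.

open import Defs
open import Level using (0ℓ)
open import Function using (id; _∘_)
open import Function.Bundles using (_⇔_; mk⇔; Equivalence)
open import Function.Definitions using (Injective)
open import Data.Empty using (⊥-elim)
open import Data.Bool using (Bool; true; false; if_then_else_; _∧_)
open import Data.Product using (∃; _×_; _,_; proj₁; proj₂)
import Data.Product.Properties as ΣP
open import Data.Sum using (_⊎_; inj₁; inj₂; [_,_])
import Data.Sum.Properties as SumP
open import Data.Maybe using (Maybe; nothing; just; maybe)
open import Data.Nat as ℕ using (ℕ; zero; suc; _≤_)
import Data.Nat.Properties as ℕP
open import Data.Integer as ℤ using (ℤ; +_; -_; _+_; _*_; _-_; _^_)
import Data.Integer.Properties as ℤP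
open import Data.Integer.Tactic.RingSolver using (solve-∀)
open import Data.Fin using (Fin; zero; suc; toℕ; punchIn)
import Data.Fin.Properties as FinP
open import Data.Fin.Subset using (Subset; ∣_∣; _∈_)
open import Data.Fin.Subset.Properties using (_∈?_)
open import Data.Vec.Base using ([]; _∷_)
import Data.Vec.Base as Vec
open import Data.List using (List; []; _∷_; _++_; map; foldr; concatMap; filter; length; tabulate; lookup; allFin)
open import Data.List.Properties using (map-++; ++-assoc; ++-identityʳ; length-map; map-∘; map-cong; map-tabulate; map-id; tabulate-lookup; tabulate-cong; length-tabulate; filter-accept; filter-reject; filter-≐; filter-all)
open import Data.List.Relation.Unary.All using (All; []; _∷_)
import Data.List.Relation.Unary.All as All
import Data.List.Relation.Unary.All.Properties as AllP
open import Data.List.Relation.Unary.Any using (here; there)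
open import Data.List.Relation.Unary.AllPairs using ([]; _∷_)
import Data.List.Relation.Unary.AllPairs.Properties as AllPairsP
open import Data.List.Relation.Unary.Unique.Propositional using (Unique)
import Data.List.Relation.Unary.Unique.Propositional.Properties as UP
open import Data.List.Membership.Propositional using () renaming (_∈_ to _∈ˡ_)
open import Data.List.Membership.Propositional.Properties using (∈-lookup; ∈-allFin)
open import Data.List.Relation.Binary.Permutation.Propositional as Perm using (_↭_)
import Data.List.Relation.Binary.Permutation.Propositional.Properties as PermP
open import Relation.Binary.Definitions using (DecidableEquality)
open import Relation.Binary.PropositionalEquality hiding ([_])
open import Relation.Nullary using (Dec; does; yes; no; ¬_; ¬?; _×-dec_)
open import Relation.Nullary.Decidable using (does-⇔; dec-true; dec-false)
open import Relation.Unary using (Pred)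
import Relation.Unary as U
open import Relation.Unary.Properties using (U?)

sgn-+ : ∀ a b → sgn (a ℕ.+ b) ≡ sgn a * sgn b
sgn-+ zero    b = sym (ℤP.*-identityˡ (sgn b))
sgn-+ (suc a) b = trans (cong -_ (sgn-+ a b)) (ℤP.neg-distribˡ-* (sgn a) (sgn b))

sgn*sgn≡1 : ∀ a → sgn a * sgn a ≡ + 1
sgn*sgn≡1 zero    = refl
sgn*sgn≡1 (suc a) = trans (ring (sgn a)) (sgn*sgn≡1 a)
  where ring : ∀ s → (- s) * (- s) ≡ s * s
        ring = solve-∀

-- detL rs cs is the determinant of the matrix (ρ c) with rows ρ ∈ rs and
-- columns c ∈ cs; it is 0 unless the two lists have the same length.

module _ {C : Set} where

  -- expand ρ f (c₀ ∷ … ∷ cₗ) = Σⱼ (-1)ʲ · ρ cⱼ · f (the list with cⱼ removed)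
  expand : (C → ℤ) → (List C → ℤ) → List C → ℤ
  expand ρ f []       = + 0
  expand ρ f (c ∷ cs) = ρ c * f cs - expand ρ (λ ds → f (c ∷ ds)) cs

  detL : List (C → ℤ) → List C → ℤ
  detL []       []      = + 1
  detL []       (_ ∷ _) = + 0
  detL (ρ ∷ rs) cs      = expand ρ (detL rs) cs

  data Drop : List C → List C → Set where
    here  : ∀ {c cs} → Drop cs (c ∷ cs)
    there : ∀ {c ds cs} → Drop ds cs → Drop (c ∷ ds) (c ∷ cs)

  Drop-length : ∀ {ds cs} → Drop ds cs → suc (length ds) ≡ length cs
  Drop-length here      = refl
  Drop-length (there d) = cong suc (Drop-length d)

  expand-cong : ∀ ρ {f g} cs → (∀ ds → Drop ds cs → f ds ≡ g ds) → expand ρ f cs ≡ expand ρ g cs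
  expand-cong ρ []       h = refl
  expand-cong ρ (c ∷ cs) h =
    cong₂ (λ a b → ρ c * a - b) (h cs here) (expand-cong ρ cs (λ ds d → h (c ∷ ds) (there d)))

  expand-cong-row : ∀ {ρ σ} → (∀ c → ρ c ≡ σ c) → ∀ f cs → expand ρ f cs ≡ expand σ f cs
  expand-cong-row h f []       = refl
  expand-cong-row h f (c ∷ cs) = cong₂ (λ a b → a * f cs - b) (h c) (expand-cong-row h _ cs)

  expand-linear : ∀ ρ f g k l cs →
                  expand ρ (λ ds → k * f ds + l * g ds) cs ≡ k * expand ρ f cs + l * expand ρ g cs
  expand-linear ρ f g k l [] = ring k l
    where ring : ∀ k l → + 0 ≡ k * + 0 + l * + 0
          ring = solve-∀
  expand-linear ρ f g k l (c ∷ cs) =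
    trans (cong (λ z → ρ c * (k * f cs + l * g cs) - z) (expand-linear ρ _ _ k l cs))
          (ring (ρ c) (f cs) (g cs) k l _ _)
    where ring : ∀ r a b k l y z → r * (k * a + l * b) - (k * y + l * z) ≡ k * (r * a - y) + l * (r * b - z)
          ring = solve-∀

  expand-*ˡ : ∀ ρ f k cs → expand ρ (λ ds → k * f ds) cs ≡ k * expand ρ f cs
  expand-*ˡ ρ f k cs = trans (expand-cong ρ cs (λ ds _ → ring k (f ds)))
                             (trans (expand-linear ρ f f k (+ 0) cs) (sym (ring k _)))
    where ring : ∀ k a → k * a ≡ k * a + + 0 * a
          ring = solve-∀

  expand-*ʳ : ∀ ρ f k cs → expand ρ (λ ds → f ds * k) cs ≡ expand ρ f cs * k
  expand-*ʳ ρ f k cs = trans (expand-cong ρ cs (λ ds _ → ℤP.*-comm (f ds) k))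
                             (trans (expand-*ˡ ρ f k cs) (ℤP.*-comm k _))

  expand-neg : ∀ ρ f cs → expand ρ (λ ds → - f ds) cs ≡ - expand ρ f cs
  expand-neg ρ f cs = trans (expand-cong ρ cs (λ ds _ → sym (ℤP.-1*i≡-i (f ds))))
                            (trans (expand-*ˡ ρ f ℤ.-1ℤ cs) (ℤP.-1*i≡-i _))

  expand-zero-row : ∀ {ρ} f cs → All (λ c → ρ c ≡ + 0) cs → expand ρ f cs ≡ + 0
  expand-zero-row f []       []       = refl
  expand-zero-row f (c ∷ cs) (e ∷ es) =
    trans (cong₂ (λ a b → a * f cs - b) e (expand-zero-row _ cs es)) (ring (f cs))
    where ring : ∀ a → + 0 * a - + 0 ≡ + 0
          ring = solve-∀

  expand-++ : ∀ ρ f xs ys → expand ρ f (xs ++ ys) ≡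
              expand ρ (λ ds → f (ds ++ ys)) xs + sgn (length xs) * expand ρ (λ ds → f (xs ++ ds)) ys
  expand-++ ρ f []       ys = ring (expand ρ f ys)
    where ring : ∀ a → a ≡ + 0 + + 1 * a
          ring = solve-∀
  expand-++ ρ f (x ∷ xs) ys =
    trans (cong (λ z → ρ x * f (xs ++ ys) - z) (expand-++ ρ (λ ds → f (x ∷ ds)) xs ys))
          (ring (ρ x * f (xs ++ ys)) _ (sgn (length xs)) _)
    where ring : ∀ a b s c → a - (b + s * c) ≡ (a - b) + (- s) * c
          ring = solve-∀

  expand-++-zero : ∀ ρ f xs ys → All (λ c → ρ c ≡ + 0) ys →
                   expand ρ f (xs ++ ys) ≡ expand ρ (λ ds → f (ds ++ ys)) xs
  expand-++-zero ρ f xs ys z =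
    trans (expand-++ ρ f xs ys)
          (trans (cong (λ w → expand ρ (λ ds → f (ds ++ ys)) xs + sgn (length xs) * w) (expand-zero-row _ ys z))
                 (ring _ (sgn (length xs))))
    where ring : ∀ a s → a + s * + 0 ≡ a
          ring = solve-∀

  expand-antisym : ∀ ρ σ f cs → expand ρ (expand σ f) cs + expand σ (expand ρ f) cs ≡ + 0
  expand-antisym ρ σ f []       = refl
  expand-antisym ρ σ f (c ∷ cs) =
    trans (cong₂ (λ a b → (ρ c * expand σ f cs - a) + (σ c * expand ρ f cs - b)) (unfold ρ σ) (unfold σ ρ))
          (trans (ring (ρ c) (σ c) (expand σ f cs) (expand ρ f cs) _ _)
                 (expand-antisym ρ σ (λ ds → f (c ∷ ds)) cs))
    where
      unfold : ∀ ρ σ → expand ρ (λ ds → σ c * f ds - expand σ (λ es → f (c ∷ es)) ds) cs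
                       ≡ σ c * expand ρ f cs + ℤ.-1ℤ * expand ρ (expand σ (λ es → f (c ∷ es))) cs
      unfold ρ σ = trans (expand-cong ρ cs (λ ds _ → minus (σ c * f ds) _))
                         (expand-linear ρ f _ (σ c) ℤ.-1ℤ cs)
        where minus : ∀ a b → a - b ≡ a + ℤ.-1ℤ * b
              minus = solve-∀
      ring : ∀ r s A B y z → (r * A - (s * B + ℤ.-1ℤ * y)) + (s * B - (r * A + ℤ.-1ℤ * z)) ≡ y + z
      ring = solve-∀

  detL-swap-rows : ∀ rs ρ σ ts cs → detL (rs ++ ρ ∷ σ ∷ ts) cs ≡ - detL (rs ++ σ ∷ ρ ∷ ts) cs
  detL-swap-rows []       ρ σ ts cs = neg-unique _ _ (expand-antisym ρ σ (detL ts) cs)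
    where neg-unique : ∀ a b → a + b ≡ + 0 → a ≡ - b
          neg-unique a b e = trans (ring a b) (trans (cong (_- b) e) (ℤP.+-identityˡ (- b)))
            where ring : ∀ a b → a ≡ (a + b) - b
                  ring = solve-∀
  detL-swap-rows (τ ∷ rs) ρ σ ts cs =
    trans (expand-cong τ cs (λ ds _ → detL-swap-rows rs ρ σ ts ds)) (expand-neg τ _ cs)

  Alternating : (List C → ℤ) → Set
  Alternating f = ∀ pre c d post → f (pre ++ c ∷ d ∷ post) ≡ - f (pre ++ d ∷ c ∷ post)

  expand-alternating : ∀ ρ f → Alternating f → Alternating (expand ρ f)
  expand-alternating ρ f alt [] c d post =
    trans (cong (λ z → ρ c * f (d ∷ post) - (ρ d * f (c ∷ post) - z)) inner)
          (ring (ρ c * f (d ∷ post)) (ρ d * f (c ∷ post)) _)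
    where
      inner : expand ρ (λ ds → f (c ∷ d ∷ ds)) post ≡ - expand ρ (λ ds → f (d ∷ c ∷ ds)) post
      inner = trans (expand-cong ρ post (λ ds _ → alt [] c d ds)) (expand-neg ρ _ post)
      ring : ∀ a b y → a - (b - (- y)) ≡ - (b - (a - y))
      ring = solve-∀
  expand-alternating ρ f alt (p ∷ pre) c d post =
    trans (cong₂ (λ a b → ρ p * a - b) (alt pre c d post)
                 (expand-alternating ρ (λ ds → f (p ∷ ds)) (λ pr → alt (p ∷ pr)) pre c d post))
          (ring (ρ p) _ _)
    where ring : ∀ r a b → r * (- a) - (- b) ≡ - (r * a - b)
          ring = solve-∀

  detL-alternating : ∀ rs → Alternating (detL rs)
  detL-alternating []       []      c d post = refl
  detL-alternating []       (_ ∷ _) c d post = refl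
  detL-alternating (ρ ∷ rs) = expand-alternating ρ (detL rs) (detL-alternating rs)

  alternating-move : ∀ f → Alternating f → ∀ v xs ws → f (v ∷ xs ++ ws) ≡ sgn (length xs) * f (xs ++ v ∷ ws)
  alternating-move f alt v []       ws = sym (ℤP.*-identityˡ _)
  alternating-move f alt v (x ∷ xs) ws =
    trans (alt [] v x (xs ++ ws))
          (trans (cong -_ (alternating-move (λ ds → f (x ∷ ds)) (λ pr → alt (x ∷ pr)) v xs ws))
                 (ℤP.neg-distribˡ-* (sgn (length xs)) _))

  alternating-swap-blocks : ∀ f → Alternating f → ∀ xs ys →
                            f (xs ++ ys) ≡ sgn (length xs ℕ.* length ys) * f (ys ++ xs)
  alternating-swap-blocks f alt []       ys = trans (cong f (sym (++-identityʳ ys))) (sym (ℤP.*-identityˡ _))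
  alternating-swap-blocks f alt (x ∷ xs) ys =
    trans (alternating-swap-blocks (λ ds → f (x ∷ ds)) (λ pr → alt (x ∷ pr)) xs ys)
          (trans (cong (sgn (length xs ℕ.* length ys) *_) (alternating-move f alt x ys xs))
                 (trans (ring (sgn (length xs ℕ.* length ys)) (sgn (length ys)) _)
                        (cong (_* f (ys ++ x ∷ xs)) (sym (sgn-+ (length ys) (length xs ℕ.* length ys))))))
    where ring : ∀ a b c → a * (b * c) ≡ (b * a) * c
          ring = solve-∀

  detL-move-row : ∀ pre ρ rs ts cs →
                  detL (pre ++ ρ ∷ rs ++ ts) cs ≡ sgn (length rs) * detL (pre ++ rs ++ ρ ∷ ts) cs
  detL-move-row pre ρ []       ts cs = sym (ℤP.*-identityˡ _)
  detL-move-row pre ρ (σ ∷ rs) ts cs = begin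
    detL (pre ++ ρ ∷ σ ∷ rs ++ ts) cs            ≡⟨ detL-swap-rows pre ρ σ (rs ++ ts) cs ⟩
    - detL (pre ++ σ ∷ ρ ∷ rs ++ ts) cs          ≡⟨ cong (λ z → - detL z cs) (sym (++-assoc pre (σ ∷ []) (ρ ∷ rs ++ ts))) ⟩
    - detL ((pre ++ (σ ∷ [])) ++ ρ ∷ rs ++ ts) cs   ≡⟨ cong -_ (detL-move-row (pre ++ (σ ∷ [])) ρ rs ts cs) ⟩
    - (s * detL ((pre ++ (σ ∷ [])) ++ rs ++ ρ ∷ ts) cs) ≡⟨ cong (λ z → - (s * detL z cs)) (++-assoc pre (σ ∷ []) (rs ++ ρ ∷ ts)) ⟩
    - (s * detL (pre ++ σ ∷ rs ++ ρ ∷ ts) cs)    ≡⟨ ℤP.neg-distribˡ-* s _ ⟩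
    - s * detL (pre ++ σ ∷ rs ++ ρ ∷ ts) cs      ∎
    where open ≡-Reasoning
          s = sgn (length rs)

  detL-swap-row-blocks : ∀ pre rs ts cs →
                         detL (pre ++ rs ++ ts) cs ≡ sgn (length rs ℕ.* length ts) * detL (pre ++ ts ++ rs) cs
  detL-swap-row-blocks pre []       ts cs =
    trans (cong (λ z → detL (pre ++ z) cs) (sym (++-identityʳ ts))) (sym (ℤP.*-identityˡ _))
  detL-swap-row-blocks pre (ρ ∷ rs) ts cs = begin
    detL (pre ++ ρ ∷ rs ++ ts) cs                 ≡⟨ cong (λ z → detL z cs) (sym (++-assoc pre (ρ ∷ []) (rs ++ ts))) ⟩
    detL ((pre ++ (ρ ∷ [])) ++ rs ++ ts) cs          ≡⟨ detL-swap-row-blocks (pre ++ (ρ ∷ [])) rs ts cs ⟩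
    s * detL ((pre ++ (ρ ∷ [])) ++ ts ++ rs) cs      ≡⟨ cong (λ z → s * detL z cs) (++-assoc pre (ρ ∷ []) (ts ++ rs)) ⟩
    s * detL (pre ++ ρ ∷ ts ++ rs) cs             ≡⟨ cong (s *_) (detL-move-row pre ρ ts rs cs) ⟩
    s * (t * detL (pre ++ ts ++ ρ ∷ rs) cs)       ≡⟨ ring s t _ ⟩
    (t * s) * detL (pre ++ ts ++ ρ ∷ rs) cs       ≡⟨ cong (_* detL (pre ++ ts ++ ρ ∷ rs) cs) (sym (sgn-+ (length ts) _)) ⟩
    sgn (length ts ℕ.+ length rs ℕ.* length ts) * detL (pre ++ ts ++ ρ ∷ rs) cs ∎
    where open ≡-Reasoning
          s = sgn (length rs ℕ.* length ts)
          t = sgn (length ts)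
          ring : ∀ a b c → a * (b * c) ≡ (b * a) * c
          ring = solve-∀

  detL-block-triangular : ∀ rs ts cs es → All (λ ρ → All (λ c → ρ c ≡ + 0) es) rs → length rs ≡ length cs →
                          detL (rs ++ ts) (cs ++ es) ≡ detL rs cs * detL ts es
  detL-block-triangular []       ts [] es _        _   = sym (ℤP.*-identityˡ _)
  detL-block-triangular (ρ ∷ rs) ts cs es (z ∷ zs) len =
    trans (expand-++-zero ρ _ cs es z)
          (trans (expand-cong ρ cs (λ ds d → detL-block-triangular rs ts ds es zs
                                                (ℕP.suc-injective (trans len (sym (Drop-length d))))))
                 (expand-*ʳ ρ (detL rs) (detL ts es) cs))

  detL-upper-block-triangular : ∀ rs ts cs es → All (λ τ → All (λ c → τ c ≡ + 0) cs) ts →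
                                length rs ≡ length cs → length ts ≡ length es →
                                detL (rs ++ ts) (cs ++ es) ≡ detL rs cs * detL ts es
  detL-upper-block-triangular rs ts cs es z lr lt = begin
    detL (rs ++ ts) (cs ++ es)                          ≡⟨ alternating-swap-blocks (detL (rs ++ ts)) (detL-alternating (rs ++ ts)) cs es ⟩
    s * detL (rs ++ ts) (es ++ cs)                      ≡⟨ cong (s *_) (detL-swap-row-blocks [] rs ts (es ++ cs)) ⟩
    s * (s′ * detL (ts ++ rs) (es ++ cs))               ≡⟨ sym (ℤP.*-assoc s s′ _) ⟩
    (s * s′) * detL (ts ++ rs) (es ++ cs)               ≡⟨ cong₂ _*_ signs (detL-block-triangular ts rs es cs z lt) ⟩
    + 1 * (detL ts es * detL rs cs)                     ≡⟨ trans (ℤP.*-identityˡ _) (ℤP.*-comm (detL ts es) (detL rs cs)) ⟩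
    detL rs cs * detL ts es                             ∎
    where
      open ≡-Reasoning
      s  = sgn (length cs ℕ.* length es)
      s′ = sgn (length rs ℕ.* length ts)
      signs : s * s′ ≡ + 1
      signs = trans (cong₂ (λ a b → s * sgn (a ℕ.* b)) lr lt) (sgn*sgn≡1 (length cs ℕ.* length es))

  minor : (C → C → ℤ) → List C → ℤ
  minor E vs = detL (map E vs) vs

  minor-swap : ∀ E pre c d post → minor E (pre ++ c ∷ d ∷ post) ≡ minor E (pre ++ d ∷ c ∷ post)
  minor-swap E pre c d post = begin
    detL (map E (pre ++ c ∷ d ∷ post)) (pre ++ c ∷ d ∷ post)
      ≡⟨ cong (λ z → detL z (pre ++ c ∷ d ∷ post)) (map-++ E pre (c ∷ d ∷ post)) ⟩
    detL (map E pre ++ E c ∷ E d ∷ map E post) (pre ++ c ∷ d ∷ post) ≡⟨ detL-swap-rows (map E pre) (E c) (E d) (map E post) _ ⟩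
    - detL rows′ (pre ++ c ∷ d ∷ post)                              ≡⟨ cong -_ (detL-alternating rows′ pre c d post) ⟩
    - - detL rows′ (pre ++ d ∷ c ∷ post)                            ≡⟨ ℤP.neg-involutive _ ⟩
    detL rows′ (pre ++ d ∷ c ∷ post)
      ≡⟨ cong (λ z → detL z (pre ++ d ∷ c ∷ post)) (sym (map-++ E pre (d ∷ c ∷ post))) ⟩
    detL (map E (pre ++ d ∷ c ∷ post)) (pre ++ d ∷ c ∷ post)       ∎
    where open ≡-Reasoning
          rows′ = map E pre ++ E d ∷ E c ∷ map E post

  minor-↭-after : ∀ E pre {xs ys} → xs ↭ ys → minor E (pre ++ xs) ≡ minor E (pre ++ ys)
  minor-↭-after E pre Perm.refl = refl
  minor-↭-after E pre {x ∷ xs} {.x ∷ ys} (Perm.prep x p) =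
    trans (cong (minor E) (sym (++-assoc pre (x ∷ []) xs)))
          (trans (minor-↭-after E (pre ++ (x ∷ [])) p) (cong (minor E) (++-assoc pre (x ∷ []) ys)))
  minor-↭-after E pre {x ∷ y ∷ xs} {.y ∷ .x ∷ ys} (Perm.swap x y p) =
    trans (minor-swap E pre x y xs)
          (trans (cong (minor E) (sym (++-assoc pre (y ∷ x ∷ []) xs)))
                 (trans (minor-↭-after E (pre ++ y ∷ (x ∷ [])) p) (cong (minor E) (++-assoc pre (y ∷ x ∷ []) ys))))
  minor-↭-after E pre (Perm.trans p q) = trans (minor-↭-after E pre p) (minor-↭-after E pre q)

  minor-↭ : ∀ E {xs ys} → xs ↭ ys → minor E xs ≡ minor E ys
  minor-↭ E = minor-↭-after E []

  NoEdges : (C → C → ℤ) → List C → List C → Set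
  NoEdges E xs ys = All (λ c → All (λ d → E c d ≡ + 0) ys) xs

  minor-++ : ∀ E xs ys → NoEdges E xs ys → minor E (xs ++ ys) ≡ minor E xs * minor E ys
  minor-++ E xs ys z =
    trans (cong (λ w → detL w (xs ++ ys)) (map-++ E xs ys))
          (detL-block-triangular (map E xs) (map E ys) xs ys (AllP.map⁺ z) (length-map E xs))

  minor-cut : ∀ E v xs ys → NoEdges E xs ys → NoEdges E ys xs →
              minor E (v ∷ xs ++ ys) ≡
              minor E (v ∷ xs) * minor E ys + minor E xs * (minor E (v ∷ ys) - E v v * minor E ys)
  minor-cut E v xs ys zxy zyx = begin
    minor E (v ∷ xs ++ ys)
      ≡⟨ cong (λ w → expand (E v) (detL w) (v ∷ xs ++ ys)) (map-++ E xs ys) ⟩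
    x * detL (Rx ++ Ry) (xs ++ ys) - expand (E v) (λ ds → detL (Rx ++ Ry) (v ∷ ds)) (xs ++ ys)
      ≡⟨ cong (λ z → x * detL (Rx ++ Ry) (xs ++ ys) - z) (expand-++ (E v) _ xs ys) ⟩
    x * detL (Rx ++ Ry) (xs ++ ys) - (expand (E v) (λ ds → detL (Rx ++ Ry) (v ∷ ds ++ ys)) xs
                                      + s * expand (E v) (λ ds → detL (Rx ++ Ry) (v ∷ xs ++ ds)) ys)
      ≡⟨ cong₂ (λ a b → x * a - b) (detL-block-triangular Rx Ry xs ys zR (length-map E xs))
                                    (cong₂ (λ a b → a + s * b) expand-xs expand-ys) ⟩
    x * (Px * Py) - (A * Py + s * (s * (B * Px)))
      ≡⟨ collect x Px Py A B s (sgn*sgn≡1 (length xs)) ⟩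
    (x * Px - A) * Py + Px * ((x * Py - B) - x * Py)
      ∎
    where
      open ≡-Reasoning
      x  = E v v
      Rx = map E xs
      Ry = map E ys
      Px = detL Rx xs
      Py = detL Ry ys
      s  = sgn (length xs)
      A  = expand (E v) (λ ds → detL Rx (v ∷ ds)) xs
      B  = expand (E v) (λ ds → detL Ry (v ∷ ds)) ys
      zR : All (λ ρ → All (λ c → ρ c ≡ + 0) ys) Rx
      zR = AllP.map⁺ zxy
      expand-xs : expand (E v) (λ ds → detL (Rx ++ Ry) (v ∷ ds ++ ys)) xs ≡ A * Py
      expand-xs = trans (expand-cong (E v) xs (λ ds d → detL-block-triangular Rx Ry (v ∷ ds) ys zR
                                                           (trans (length-map E xs) (sym (Drop-length d)))))
                        (expand-*ʳ (E v) _ Py xs)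
      minor-ys : ∀ ds → Drop ds ys → detL (Rx ++ Ry) (v ∷ xs ++ ds) ≡ s * (detL Ry (v ∷ ds) * Px)
      minor-ys ds d =
        trans (alternating-move (detL (Rx ++ Ry)) (detL-alternating (Rx ++ Ry)) v xs ds)
              (cong (s *_) (trans (detL-upper-block-triangular Rx Ry xs (v ∷ ds) (AllP.map⁺ zyx) (length-map E xs)
                                                               (trans (length-map E ys) (sym (Drop-length d))))
                                  (ℤP.*-comm Px _)))
      expand-ys : expand (E v) (λ ds → detL (Rx ++ Ry) (v ∷ xs ++ ds)) ys ≡ s * (B * Px)
      expand-ys = trans (expand-cong (E v) ys minor-ys)
                        (trans (expand-*ˡ (E v) _ s ys) (cong (s *_) (expand-*ʳ (E v) _ Px ys)))
      collect : ∀ x X Y A B s → s * s ≡ + 1 →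
            x * (X * Y) - (A * Y + s * (s * (B * X))) ≡ (x * X - A) * Y + X * ((x * Y - B) - x * Y)
      collect x X Y A B s ss = trans (cong (λ t → x * (X * Y) - (A * Y + t)) (trans (sym (ℤP.*-assoc s s _))
                                   (trans (cong (_* (B * X)) ss) (ℤP.*-identityˡ _))))
                                 (ring x X Y A B)
        where ring : ∀ x X Y A B → x * (X * Y) - (A * Y + B * X) ≡ (x * X - A) * Y + X * ((x * Y - B) - x * Y)
              ring = solve-∀

-- Characteristic polynomials as principal minors

expand-map : ∀ {A C : Set} (f : A → C) ρ g cs → expand ρ g (map f cs) ≡ expand (λ c → ρ (f c)) (λ ds → g (map f ds)) cs
expand-map f ρ g []       = refl
expand-map f ρ g (c ∷ cs) = cong (λ z → ρ (f c) * g (map f cs) - z) (expand-map f ρ (λ ds → g (f c ∷ ds)) cs)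

detL-map : ∀ {A C : Set} (f : A → C) rs cs → detL rs (map f cs) ≡ detL (map (λ ρ c → ρ (f c)) rs) cs
detL-map f []       []      = refl
detL-map f []       (_ ∷ _) = refl
detL-map f (ρ ∷ rs) cs      = trans (expand-map f ρ (detL rs) cs) (expand-cong _ cs (λ ds _ → detL-map f rs ds))

detL-cong-rows : ∀ {A C : Set} {F G : A → C → ℤ} → (∀ z c → F z c ≡ G z c) → ∀ zs cs → detL (map F zs) cs ≡ detL (map G zs) cs
detL-cong-rows h []       cs = refl
detL-cong-rows h (z ∷ zs) cs = trans (expand-cong-row (h z) _ cs) (expand-cong _ cs (λ ds _ → detL-cong-rows h zs ds))

minor-map : ∀ {A C : Set} (E : C → C → ℤ) (f : A → C) zs → minor E (map f zs) ≡ minor (λ z z′ → E (f z) (f z′)) zs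
minor-map E f zs = trans (detL-map f (map E (map f zs)) zs) (cong (λ w → detL w zs) (trans (sym (map-∘ (map f zs))) (sym (map-∘ zs))))

minor-cong : ∀ {C : Set} {E F : C → C → ℤ} → (∀ z z′ → E z z′ ≡ F z z′) → ∀ zs → minor E zs ≡ minor F zs
minor-cong h zs = detL-cong-rows h zs zs

minor-relabel : ∀ {A B C : Set} (E : B → B → ℤ) (F : C → C → ℤ) (f : A → B) (g : A → C) →
                (∀ z z′ → E (f z) (f z′) ≡ F (g z) (g z′)) → ∀ zs → minor E (map f zs) ≡ minor F (map g zs)
minor-relabel E F f g h zs = trans (minor-map E f zs) (trans (minor-cong h zs) (sym (minor-map F g zs)))

sumℤ-neg : ∀ n (h : Fin n → ℤ) → sumℤ (tabulate (λ j → - h j)) ≡ - sumℤ (tabulate h)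
sumℤ-neg zero    h = refl
sumℤ-neg (suc n) h = trans (cong (λ z → - h zero + z) (sumℤ-neg n (λ j → h (suc j)))) (sym (ℤP.neg-distrib-+ (h zero) _))

expand-tabulate : ∀ {C : Set} n (ρ : C → ℤ) f (g : Fin (suc n) → C) →
                  expand ρ f (tabulate g) ≡ sumℤ (tabulate (λ j → sgn (toℕ j) * ρ (g j) * f (tabulate (λ l → g (punchIn j l)))))
expand-tabulate zero    ρ f g = ring (ρ (g zero)) (f [])
  where ring : ∀ a b → a * b - + 0 ≡ + 1 * a * b + + 0
        ring = solve-∀
expand-tabulate (suc n) ρ f g =
  trans (cong (λ z → ρ (g zero) * f (tabulate (λ l → g (suc l))) - z) (expand-tabulate n ρ (λ ds → f (g zero ∷ ds)) (λ l → g (suc l))))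
        (trans (ring (ρ (g zero)) (f (tabulate (λ l → g (suc l)))) _)
               (cong (λ z → + 1 * ρ (g zero) * f (tabulate (λ l → g (suc l))) + z)
                     (trans (sym (sumℤ-neg (suc n) H))
                            (cong sumℤ (tabulate-cong (λ j → neg-sign (sgn (toℕ j)) (ρ (g (suc j))) (f (tabulate (λ l → g (punchIn (suc j) l))))))))))
  where neg-sign : ∀ s a b → - (s * a * b) ≡ (- s) * a * b
        neg-sign = solve-∀
        ring : ∀ a b S → a * b - S ≡ + 1 * a * b + (- S)
        ring = solve-∀
        H : Fin (suc n) → ℤ
        H j = sgn (toℕ j) * ρ (g (suc j)) * f (g zero ∷ tabulate (λ l → g (suc (punchIn j l))))

det≡detL : ∀ {C : Set} n (ρs : Fin n → C → ℤ) (g : Fin n → C) → det (λ i j → ρs i (g j)) ≡ detL (tabulate ρs) (tabulate g)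
det≡detL zero    ρs g = refl
det≡detL (suc n) ρs g =
  trans (cong sumℤ (trans (map-tabulate id (λ j → sgn (toℕ j) * ρs zero (g j) * det (λ i l → ρs (suc i) (g (punchIn j l)))))
                          (tabulate-cong (λ j → cong (sgn (toℕ j) * ρs zero (g j) *_)
                                                                (det≡detL n (λ i → ρs (suc i)) (λ l → g (punchIn j l)))))))
        (sym (expand-tabulate n (ρs zero) (detL (tabulate (λ i → ρs (suc i)))) g))

lookup-injective : ∀ {A : Set} (xs : List A) → Unique xs → ∀ i j → lookup xs i ≡ lookup xs j → i ≡ j
lookup-injective (x ∷ xs) (_ ∷ _)  zero    zero    e = refl
lookup-injective (x ∷ xs) (a ∷ _)  zero    (suc j) e = ⊥-elim (All.lookup a (∈-lookup j) e)
lookup-injective (x ∷ xs) (a ∷ _)  (suc i) zero    e = ⊥-elim (All.lookup a (∈-lookup i) (sym e))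
lookup-injective (x ∷ xs) (_ ∷ us) (suc i) (suc j) e = cong suc (lookup-injective xs us i j e)

charMatrix : {V : Set} → DecidableEquality V → (V → V → Bool) → ℤ → V → V → ℤ
charMatrix _≟_ a x v w = (if does (v ≟ w) then x else + 0) - boolℤ (a v w)

charPolyOn≡minor : ∀ {V : Set} (_≟_ : DecidableEquality V) a vs x → Unique vs →
                   charPolyOn a vs x ≡ minor (charMatrix _≟_ a x) vs
charPolyOn≡minor _≟_ a vs x u = begin
  charPolyOn a vs x                               ≡⟨ det≡detL (length vs) M id ⟩
  detL (tabulate M) (allFin (length vs))          ≡⟨ cong (λ w → detL w (allFin (length vs))) (sym (map-tabulate id M)) ⟩
  minor M (allFin (length vs))                    ≡⟨ minor-cong same-entries (allFin (length vs)) ⟩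
  minor (λ i j → charMatrix _≟_ a x (lookup vs i) (lookup vs j)) (allFin (length vs))
                                                  ≡⟨ sym (minor-map (charMatrix _≟_ a x) (lookup vs) (allFin (length vs))) ⟩
  minor (charMatrix _≟_ a x) (map (lookup vs) (allFin (length vs)))
                                                  ≡⟨ cong (minor (charMatrix _≟_ a x)) (trans (map-tabulate id (lookup vs)) (tabulate-lookup vs)) ⟩
  minor (charMatrix _≟_ a x) vs                   ∎
  where
    open ≡-Reasoning
    M : Fin (length vs) → Fin (length vs) → ℤ
    M = charMatrix FinP._≟_ (λ i j → a (lookup vs i) (lookup vs j)) x
    same-entries : ∀ i j → M i j ≡ charMatrix _≟_ a x (lookup vs i) (lookup vs j)
    same-entries i j = cong (λ b → (if b then x else + 0) - boolℤ (a (lookup vs i) (lookup vs j)))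
                            (does-⇔ (mk⇔ (cong (lookup vs)) (lookup-injective vs u i j)) (i FinP.≟ j) (lookup vs i ≟ lookup vs j))

sumℤ-++ : ∀ xs ys → sumℤ (xs ++ ys) ≡ sumℤ xs + sumℤ ys
sumℤ-++ []       ys = sym (ℤP.+-identityˡ _)
sumℤ-++ (z ∷ xs) ys = trans (cong (λ w → z + w) (sumℤ-++ xs ys)) (sym (ℤP.+-assoc z _ _))

sumℤ-*ʳ : ∀ {A : Set} (f : A → ℤ) c xs → sumℤ (map (λ y → f y * c) xs) ≡ sumℤ (map f xs) * c
sumℤ-*ʳ f c []       = refl
sumℤ-*ʳ f c (y ∷ xs) = trans (cong (λ w → f y * c + w) (sumℤ-*ʳ f c xs)) (sym (ℤP.*-distribʳ-+ c (f y) _))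

map-allFin-suc : ∀ {A : Set} {l} (g : Fin (suc l) → A) → map g (allFin (suc l)) ≡ g zero ∷ map (λ j → g (suc j)) (allFin l)
map-allFin-suc g = trans (map-tabulate id g) (cong (g zero ∷_) (sym (map-tabulate id (λ j → g (suc j)))))

sumAll-suc : ∀ {l} (b : Fin (suc l) → ℕ) → sumAll b ≡ b zero ℕ.+ sumAll (λ j → b (suc j))
sumAll-suc b = cong (foldr ℕ._+_ 0) (map-allFin-suc b)

prodIn-outside : ∀ {l} (b : Fin (suc l) → ℕ) I → prodIn b (false ∷ I) ≡ prodIn (λ j → b (suc j)) I
prodIn-outside b I = trans (cong (foldr ℕ._*_ 1) (map-allFin-suc (λ j → if Vec.lookup (false ∷ I) j then b j else 1)))
                           (ℕP.*-identityˡ _)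

prodIn-inside : ∀ {l} (b : Fin (suc l) → ℕ) I → prodIn b (true ∷ I) ≡ b zero ℕ.* prodIn (λ j → b (suc j)) I
prodIn-inside b I = cong (foldr ℕ._*_ 1) (map-allFin-suc (λ j → if Vec.lookup (true ∷ I) j then b j else 1))

∣I∣≤sumAll : ∀ {l} (b : Fin l → ℕ) → (∀ j → 1 ≤ b j) → (I : Subset l) → ∣ I ∣ ≤ sumAll b
∣I∣≤sumAll b pos []          = ℕ.z≤n
∣I∣≤sumAll b pos (false ∷ I) = subst (∣ I ∣ ≤_) (sym (sumAll-suc b))
  (ℕP.≤-trans (∣I∣≤sumAll (λ j → b (suc j)) (λ j → pos (suc j)) I) (ℕP.m≤n+m _ (b zero)))
∣I∣≤sumAll b pos (true ∷ I)  = subst (suc ∣ I ∣ ≤_) (sym (sumAll-suc b))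
  (ℕP.+-mono-≤ (pos zero) (∣I∣≤sumAll (λ j → b (suc j)) (λ j → pos (suc j)) I))

weight : ∀ {l} → (Fin l → ℕ) → ℤ → ℤ → Subset l → ℤ
weight b Q R I = + prodIn b I * Q ^ ∣ I ∣ * R ^ (sumAll b ℕ.∸ ∣ I ∣)

weight-outside : ∀ {l} (b : Fin (suc l) → ℕ) Q R → (∀ j → 1 ≤ b (suc j)) → ∀ I →
                 weight b Q R (false ∷ I) ≡ weight (λ j → b (suc j)) Q R I * R ^ b zero
weight-outside b Q R pos I = begin
  + prodIn b (false ∷ I) * Q ^ ∣ I ∣ * R ^ (sumAll b ℕ.∸ ∣ I ∣)
    ≡⟨ cong₂ (λ p e → + p * Q ^ ∣ I ∣ * R ^ e) (prodIn-outside b I) exponent ⟩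
  + prodIn b′ I * Q ^ ∣ I ∣ * R ^ (b zero ℕ.+ (sumAll b′ ℕ.∸ ∣ I ∣))
    ≡⟨ cong (+ prodIn b′ I * Q ^ ∣ I ∣ *_) (ℤP.^-distribˡ-+-* R (b zero) _) ⟩
  + prodIn b′ I * Q ^ ∣ I ∣ * (R ^ b zero * R ^ (sumAll b′ ℕ.∸ ∣ I ∣))
    ≡⟨ ring (+ prodIn b′ I) (Q ^ ∣ I ∣) (R ^ b zero) _ ⟩
  + prodIn b′ I * Q ^ ∣ I ∣ * R ^ (sumAll b′ ℕ.∸ ∣ I ∣) * R ^ b zero
    ∎
  where
    open ≡-Reasoning
    b′ = λ j → b (suc j)
    exponent : sumAll b ℕ.∸ ∣ I ∣ ≡ b zero ℕ.+ (sumAll b′ ℕ.∸ ∣ I ∣)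
    exponent = trans (cong (ℕ._∸ ∣ I ∣) (sumAll-suc b)) (ℕP.+-∸-assoc (b zero) (∣I∣≤sumAll b′ pos I))
    ring : ∀ p q s t → p * q * (s * t) ≡ p * q * t * s
    ring = solve-∀

weight-inside : ∀ {l} (b : Fin (suc l) → ℕ) Q R → (∀ j → 1 ≤ b j) → ∀ I →
                weight b Q R (true ∷ I) ≡ weight (λ j → b (suc j)) Q R I * (+ b zero * Q * R ^ (b zero ℕ.∸ 1))
weight-inside b Q R pos I = begin
  + prodIn b (true ∷ I) * (Q * Q ^ ∣ I ∣) * R ^ (sumAll b ℕ.∸ suc ∣ I ∣)
    ≡⟨ cong₂ (λ p e → + p * (Q * Q ^ ∣ I ∣) * R ^ e) (prodIn-inside b I) exponent ⟩
  + (b zero ℕ.* prodIn b′ I) * (Q * Q ^ ∣ I ∣) * R ^ ((b zero ℕ.∸ 1) ℕ.+ (sumAll b′ ℕ.∸ ∣ I ∣))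
    ≡⟨ cong₂ (λ p z → p * (Q * Q ^ ∣ I ∣) * z) (ℤP.pos-* (b zero) (prodIn b′ I)) (ℤP.^-distribˡ-+-* R (b zero ℕ.∸ 1) _) ⟩
  + b zero * + prodIn b′ I * (Q * Q ^ ∣ I ∣) * (R ^ (b zero ℕ.∸ 1) * R ^ (sumAll b′ ℕ.∸ ∣ I ∣))
    ≡⟨ ring (+ b zero) (+ prodIn b′ I) Q (Q ^ ∣ I ∣) (R ^ (b zero ℕ.∸ 1)) _ ⟩
  + prodIn b′ I * Q ^ ∣ I ∣ * R ^ (sumAll b′ ℕ.∸ ∣ I ∣) * (+ b zero * Q * R ^ (b zero ℕ.∸ 1))
    ∎
  where
    open ≡-Reasoning
    b′ = λ j → b (suc j)
    exponent : sumAll b ℕ.∸ suc ∣ I ∣ ≡ (b zero ℕ.∸ 1) ℕ.+ (sumAll b′ ℕ.∸ ∣ I ∣)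
    exponent with b zero | pos zero | sumAll-suc b
    ... | suc c | _ | eq = trans (cong (ℕ._∸ suc ∣ I ∣) eq) (ℕP.+-∸-assoc c (∣I∣≤sumAll b′ (λ j → pos (suc j)) I))
    ring : ∀ a p q q′ s t → a * p * (q * q′) * (s * t) ≡ p * q′ * t * (a * q * s)
    ring = solve-∀

module _ {A : Set} (_≟_ : DecidableEquality A) {L : Pred A 0ℓ} (L? : U.Decidable L) where

  without? : (s : A) → U.Decidable (λ t → L t × t ≢ s)
  without? s t = L? t ×-dec ¬? (t ≟ s)

  filter-without-absent : ∀ s {ys} → All (_≢ s) ys → filter L? ys ≡ filter (without? s) ys
  filter-without-absent s {[]}     []         = refl
  filter-without-absent s {y ∷ ys} (y≢s ∷ ne) = by-cases (L? y)
    where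
      by-cases : Dec (L y) → filter L? (y ∷ ys) ≡ filter (without? s) (y ∷ ys)
      by-cases (yes Ly) = begin
        filter L? (y ∷ ys)               ≡⟨ filter-accept L? Ly ⟩
        y ∷ filter L? ys                 ≡⟨ cong (y ∷_) (filter-without-absent s ne) ⟩
        y ∷ filter (without? s) ys       ≡⟨ sym (filter-accept (without? s) (Ly , y≢s)) ⟩
        filter (without? s) (y ∷ ys)     ∎
        where open ≡-Reasoning
      by-cases (no ¬Ly) = begin
        filter L? (y ∷ ys)               ≡⟨ filter-reject L? ¬Ly ⟩
        filter L? ys                     ≡⟨ filter-without-absent s ne ⟩
        filter (without? s) ys           ≡⟨ sym (filter-reject (without? s) (¬Ly ∘ proj₁)) ⟩
        filter (without? s) (y ∷ ys)     ∎
        where open ≡-Reasoning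

  filter-↭-pick : ∀ {s ys} → Unique ys → s ∈ˡ ys → L s → filter L? ys ↭ s ∷ filter (without? s) ys
  filter-↭-pick {s} {.s ∷ ys} (s≢ ∷ _) (here refl) Ls = begin
    filter L? (s ∷ ys)               ≡⟨ filter-accept L? Ls ⟩
    s ∷ filter L? ys                 ≡⟨ cong (s ∷_) (filter-without-absent s (All.map (λ s≢y y≡s → s≢y (sym y≡s)) s≢)) ⟩
    s ∷ filter (without? s) ys       ≡⟨ cong (s ∷_) (sym (filter-reject (without? s) (λ (_ , s≢s) → s≢s refl))) ⟩
    s ∷ filter (without? s) (s ∷ ys) ∎
    where open Perm.PermutationReasoning
  filter-↭-pick {s} {y ∷ ys} (y≢ ∷ us) (there s∈ys) Ls = by-cases (L? y)
    where
      open Perm.PermutationReasoning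
      y≢s = All.lookup y≢ s∈ys
      by-cases : Dec (L y) → filter L? (y ∷ ys) ↭ s ∷ filter (without? s) (y ∷ ys)
      by-cases (yes Ly) = begin
        filter L? (y ∷ ys)               ≡⟨ filter-accept L? Ly ⟩
        y ∷ filter L? ys                 ↭⟨ Perm.prep y (filter-↭-pick us s∈ys Ls) ⟩
        y ∷ s ∷ filter (without? s) ys   ↭⟨ Perm.swap y s Perm.refl ⟩
        s ∷ y ∷ filter (without? s) ys   ≡⟨ cong (s ∷_) (sym (filter-accept (without? s) (Ly , y≢s))) ⟩
        s ∷ filter (without? s) (y ∷ ys) ∎
      by-cases (no ¬Ly) = begin
        filter L? (y ∷ ys)               ≡⟨ filter-reject L? ¬Ly ⟩
        filter L? ys                     ↭⟨ filter-↭-pick us s∈ys Ls ⟩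
        s ∷ filter (without? s) ys       ≡⟨ cong (s ∷_) (sym (filter-reject (without? s) (¬Ly ∘ proj₁))) ⟩
        s ∷ filter (without? s) (y ∷ ys) ∎

allFin-↭-punchIn : ∀ m (r : Fin (suc m)) → allFin (suc m) ↭ r ∷ map (punchIn r) (allFin m)
allFin-↭-punchIn m       zero    = Perm.↭-reflexive (cong (zero ∷_) (sym (map-tabulate id (punchIn zero))))
allFin-↭-punchIn (suc m) (suc r) = begin
  zero ∷ tabulate suc                         ≡⟨ cong (zero ∷_) (sym (map-tabulate id suc)) ⟩
  zero ∷ map suc (allFin (suc m))             ↭⟨ Perm.prep zero (PermP.map⁺ suc (allFin-↭-punchIn m r)) ⟩
  zero ∷ suc r ∷ map suc (map (punchIn r) (allFin m))  ↭⟨ Perm.swap zero (suc r) Perm.refl ⟩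
  suc r ∷ zero ∷ map suc (map (punchIn r) (allFin m))  ≡⟨ cong (λ z → suc r ∷ zero ∷ z) (sym (map-∘ (allFin m))) ⟩
  suc r ∷ zero ∷ map (suc ∘ punchIn r) (allFin m)      ≡⟨ cong (λ z → suc r ∷ zero ∷ z)
                                                             (trans (map-tabulate id _) (sym (map-tabulate suc (punchIn (suc r))))) ⟩
  suc r ∷ map (punchIn (suc r)) (allFin (suc m)) ∎
  where open Perm.PermutationReasoning

module Coalescence {n k m} (T : Graph n) (u : Fin k → Fin n) (u-injective : Injective _≡_ _≡_ u)
                   (G : Graph (suc m)) (r : Fin (suc m)) (a : Fin k → ℕ) (x : ℤ) where

  V : Set
  V = CoalV n k a m

  _≟V_ : DecidableEquality V
  _≟V_ = SumP.≡-dec FinP._≟_ (ΣP.≡-dec FinP._≟_ (ΣP.≡-dec FinP._≟_ FinP._≟_))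

  E : V → V → ℤ
  E = charMatrix _≟V_ (coalAdj T u a G r) x

  ET : Fin n → Fin n → ℤ
  ET = charMatrix FinP._≟_ (adj T) x

  EG : Fin (suc m) → Fin (suc m) → ℤ
  EG = charMatrix FinP._≟_ (adj G) x

  R Q : ℤ
  R = PminusRoot G r x
  Q = P G x - x * R

  vertex : ∀ i → Fin (a i) → Fin m → V
  vertex i c w = inj₂ (i , c , w)

  diagonal : ∀ {N} (H : Graph N) v → charMatrix FinP._≟_ (adj H) x v v ≡ x
  diagonal H v = trans (cong₂ (λ b e → (if b then x else + 0) - boolℤ e) (dec-true (v FinP.≟ v) refl) (irrefl H v))
                       (ℤP.+-identityʳ x)

  E-tree : ∀ s t → E (inj₁ s) (inj₁ t) ≡ ET s t
  E-tree s t = cong (λ b → (if b then x else + 0) - boolℤ (adj T s t))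
                    (does-⇔ (mk⇔ (λ { refl → refl }) (cong inj₁)) (inj₁ s ≟V inj₁ t) (s FinP.≟ t))

  E-copy : ∀ i c w w′ → E (vertex i c w) (vertex i c w′) ≡ EG (punchIn r w) (punchIn r w′)
  E-copy i c w w′ =
    cong₂ (λ b e → (if b then x else + 0) - boolℤ e)
          (does-⇔ (mk⇔ (λ { refl → refl }) (cong (vertex i c) ∘ FinP.punchIn-injective r w w′))
                  (vertex i c w ≟V vertex i c w′) (punchIn r w FinP.≟ punchIn r w′))
          (cong₂ (λ b₁ b₂ → b₁ ∧ b₂ ∧ adj G (punchIn r w) (punchIn r w′))
                 (dec-true (i FinP.≟ i) refl) (dec-true (toℕ c ℕP.≟ toℕ c) refl))

  E-other-copy : ∀ i {c c′} w w′ → c ≢ c′ → E (vertex i c w) (vertex i c′ w′) ≡ + 0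
  E-other-copy i {c} {c′} w w′ c≢c′ =
    cong₂ (λ b e → (if b then x else + 0) - boolℤ e)
          (dec-false (vertex i c w ≟V vertex i c′ w′) (λ { refl → c≢c′ refl }))
          (cong₂ (λ b₁ b₂ → b₁ ∧ b₂ ∧ adj G (punchIn r w) (punchIn r w′))
                 (dec-true (i FinP.≟ i) refl) (dec-false (toℕ c ℕP.≟ toℕ c′) (c≢c′ ∘ FinP.toℕ-injective)))

  E-other-branch : ∀ {i j} c c′ w w′ → i ≢ j → E (vertex i c w) (vertex j c′ w′) ≡ + 0
  E-other-branch {i} {j} c c′ w w′ i≢j =
    cong₂ (λ b e → (if b then x else + 0) - boolℤ e)
          (dec-false (vertex i c w ≟V vertex j c′ w′) (λ { refl → i≢j refl }))
          (cong (λ b → b ∧ does (toℕ c ℕP.≟ toℕ c′) ∧ adj G (punchIn r w) (punchIn r w′)) (dec-false (i FinP.≟ j) i≢j))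

  E-tree-branch : ∀ s i c w → u i ≢ s → E (inj₁ s) (vertex i c w) ≡ + 0
  E-tree-branch s i c w ui≢s = cong (λ b → + 0 - boolℤ (b ∧ adj G r (punchIn r w))) (dec-false (u i FinP.≟ s) ui≢s)

  E-branch-tree : ∀ s i c w → u i ≢ s → E (vertex i c w) (inj₁ s) ≡ + 0
  E-branch-tree s i c w ui≢s = cong (λ b → + 0 - boolℤ (b ∧ adj G (punchIn r w) r)) (dec-false (u i FinP.≟ s) ui≢s)

  E-root-branch : ∀ i c w → E (inj₁ (u i)) (vertex i c w) ≡ EG r (punchIn r w)
  E-root-branch i c w =
    cong₂ (λ b₁ b₂ → (if b₁ then x else + 0) - boolℤ (b₂ ∧ adj G r (punchIn r w)))
          (sym (dec-false (r FinP.≟ punchIn r w) (FinP.punchInᵢ≢i r w ∘ sym))) (dec-true (u i FinP.≟ u i) refl)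

  E-branch-root : ∀ i c w → E (vertex i c w) (inj₁ (u i)) ≡ EG (punchIn r w) r
  E-branch-root i c w =
    cong₂ (λ b₁ b₂ → (if b₁ then x else + 0) - boolℤ (b₂ ∧ adj G (punchIn r w) r))
          (sym (dec-false (punchIn r w FinP.≟ r) (FinP.punchInᵢ≢i r w))) (dec-true (u i FinP.≟ u i) refl)

  E-root : ∀ s → E (inj₁ s) (inj₁ s) ≡ x
  E-root s = trans (E-tree s s) (diagonal T s)

  copy : ∀ i → Fin (a i) → List V
  copy i c = map (vertex i c) (allFin m)

  copies : ∀ i → List (Fin (a i)) → List V
  copies i = concatMap (copy i)

  branch : Fin k → List V
  branch i = copies i (allFin (a i))

  branches : List (Fin k) → List V
  branches = concatMap branch

  All-copy : ∀ {Pr : V → Set} i c → (∀ w → Pr (vertex i c w)) → All Pr (copy i c)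
  All-copy i c h = AllP.map⁺ (All.universal h (allFin m))

  All-copies : ∀ {Pr : V → Set} i cs → All (λ c → ∀ w → Pr (vertex i c w)) cs → All Pr (copies i cs)
  All-copies i cs hs = AllP.concat⁺ (AllP.map⁺ (All.map (All-copy i _) hs))

  All-branch : ∀ {Pr : V → Set} i → (∀ c w → Pr (vertex i c w)) → All Pr (branch i)
  All-branch i h = All-copies i (allFin (a i)) (All.universal h _)

  All-branches : ∀ {Pr : V → Set} is → All (λ j → ∀ c w → Pr (vertex j c w)) is → All Pr (branches is)
  All-branches is hs = AllP.concat⁺ (AllP.map⁺ (All.map (All-branch _) hs))

  R≡minor : R ≡ minor EG (map (punchIn r) (allFin m))
  R≡minor = charPolyOn≡minor FinP._≟_ (adj G) _ x (UP.map⁺ (FinP.punchIn-injective r _ _) (UP.allFin⁺ m))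

  PG≡minor : P G x ≡ minor EG (r ∷ map (punchIn r) (allFin m))
  PG≡minor = trans (charPolyOn≡minor FinP._≟_ (adj G) (allFin (suc m)) x (UP.allFin⁺ (suc m)))
                   (minor-↭ EG (allFin-↭-punchIn m r))

  minor-copy : ∀ i c → minor E (copy i c) ≡ R
  minor-copy i c = trans (minor-relabel E EG (vertex i c) (punchIn r) (E-copy i c) (allFin m)) (sym R≡minor)

  -- A copy of G - r together with the attachment vertex u i is a copy of G, the
  -- root playing the role of u i.
  minor-rooted-copy : ∀ i c → minor E (inj₁ (u i) ∷ copy i c) ≡ P G x
  minor-rooted-copy i c = begin
    minor E (inj₁ (u i) ∷ map (vertex i c) (allFin m))     ≡⟨ cong (λ z → minor E (inj₁ (u i) ∷ z)) (map-∘ (allFin m)) ⟩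
    minor E (map f (nothing ∷ map just (allFin m)))        ≡⟨ minor-relabel E EG f g same-entries (nothing ∷ map just (allFin m)) ⟩
    minor EG (map g (nothing ∷ map just (allFin m)))       ≡⟨ cong (λ z → minor EG (r ∷ z)) (sym (map-∘ (allFin m))) ⟩
    minor EG (r ∷ map (punchIn r) (allFin m))              ≡⟨ sym PG≡minor ⟩
    P G x                                                  ∎
    where
      open ≡-Reasoning
      f : Maybe (Fin m) → V
      f = maybe (vertex i c) (inj₁ (u i))
      g : Maybe (Fin m) → Fin (suc m)
      g = maybe (punchIn r) r
      same-entries : ∀ z z′ → E (f z) (f z′) ≡ EG (g z) (g z′)
      same-entries nothing  nothing   = trans (E-root (u i)) (sym (diagonal G r))
      same-entries nothing  (just w)  = E-root-branch i c w
      same-entries (just w) nothing   = E-branch-root i c w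
      same-entries (just w) (just w′) = E-copy i c w w′

  copy-NoEdges : ∀ i c cs → All (c ≢_) cs → NoEdges E (copy i c) (copies i cs)
  copy-NoEdges i c cs c∉cs =
    All-copy i c (λ w → All-copies i cs (All.map (λ c≢c′ w′ → E-other-copy i w w′ c≢c′) c∉cs))

  copies-NoEdges : ∀ i c cs → All (c ≢_) cs → NoEdges E (copies i cs) (copy i c)
  copies-NoEdges i c cs c∉cs =
    All-copies i cs (All.map (λ c≢c′ w′ → All-copy i c (λ w → E-other-copy i w′ w (c≢c′ ∘ sym))) c∉cs)

  minor-copies : ∀ i cs → Unique cs → minor E (copies i cs) ≡ R ^ length cs
  minor-copies i []       _            = refl
  minor-copies i (c ∷ cs) (c∉cs ∷ us) =
    trans (minor-++ E (copy i c) (copies i cs) (copy-NoEdges i c cs c∉cs))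
          (cong₂ _*_ (minor-copy i c) (minor-copies i cs us))

  minor-rooted-copies : ∀ i cs → Unique cs →
                        minor E (inj₁ (u i) ∷ copies i cs) - x * minor E (copies i cs) ≡ + length cs * Q * R ^ (length cs ℕ.∸ 1)
  minor-rooted-copies i []       _            = trans (cong (λ d → d * + 1 - + 0 - x * + 1) (E-root (u i))) (ring x Q)
    where ring : ∀ x Q → x * + 1 - + 0 - x * + 1 ≡ + 0 * Q * + 1
          ring = solve-∀
  minor-rooted-copies i (c ∷ cs) (c∉cs ∷ us) = begin
    minor E (v ∷ copy i c ++ copies i cs) - x * minor E (copy i c ++ copies i cs)
      ≡⟨ cong₂ (λ A B → A - x * B) (minor-cut E v (copy i c) (copies i cs) (copy-NoEdges i c cs c∉cs) (copies-NoEdges i c cs c∉cs))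
                                   (minor-++ E (copy i c) (copies i cs) (copy-NoEdges i c cs c∉cs)) ⟩
    minor E (v ∷ copy i c) * Pcs + P₁ * (minor E (v ∷ copies i cs) - E v v * Pcs) - x * (P₁ * Pcs)
      ≡⟨ cong (λ d → minor E (v ∷ copy i c) * Pcs + P₁ * (minor E (v ∷ copies i cs) - d * Pcs) - x * (P₁ * Pcs)) (E-root (u i)) ⟩
    minor E (v ∷ copy i c) * Pcs + P₁ * (minor E (v ∷ copies i cs) - x * Pcs) - x * (P₁ * Pcs)
      ≡⟨ cong₂ (λ A B → A * Pcs + P₁ * B - x * (P₁ * Pcs)) (minor-rooted-copy i c) (minor-rooted-copies i cs us) ⟩
    P G x * Pcs + P₁ * (+ l * Q * R ^ (l ℕ.∸ 1)) - x * (P₁ * Pcs)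
      ≡⟨ cong₂ (λ A B → P G x * B + A * (+ l * Q * R ^ (l ℕ.∸ 1)) - x * (A * B)) (minor-copy i c) (minor-copies i cs us) ⟩
    P G x * R ^ l + R * (+ l * Q * R ^ (l ℕ.∸ 1)) - x * (R * R ^ l)
      ≡⟨ counting l ⟩
    + suc l * Q * R ^ l
      ∎
    where
      open ≡-Reasoning
      v   = inj₁ (u i)
      l   = length cs
      P₁  = minor E (copy i c)
      Pcs = minor E (copies i cs)
      counting : ∀ l → P G x * R ^ l + R * (+ l * Q * R ^ (l ℕ.∸ 1)) - x * (R * R ^ l) ≡ + suc l * Q * R ^ l
      counting zero    = ring (P G x) R x
        where ring : ∀ p R x → p * + 1 + R * (+ 0 * (p - x * R) * + 1) - x * (R * + 1) ≡ + 1 * (p - x * R) * + 1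
              ring = solve-∀
      counting (suc l) = ring (P G x) R x (R ^ l) (+ l)
        where ring : ∀ p R x S L → p * (R * S) + R * ((+ 1 + L) * (p - x * R) * S) - x * (R * (R * S))
                                  ≡ (+ 1 + (+ 1 + L)) * (p - x * R) * (R * S)
              ring = solve-∀

  treePart : ∀ {L : Pred (Fin n) 0ℓ} → U.Decidable L → List V
  treePart L? = map inj₁ (filter L? (allFin n))

  PT : ∀ {L : Pred (Fin n) 0ℓ} → U.Decidable L → ℤ
  PT L? = charPolyOn (adj T) (filter L? (allFin n)) x

  minor-treePart : ∀ {L} (L? : U.Decidable L) → minor E (treePart L?) ≡ PT L?
  minor-treePart L? = begin
    minor E (map inj₁ (filter L? (allFin n)))   ≡⟨ minor-relabel E ET inj₁ id E-tree (filter L? (allFin n)) ⟩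
    minor ET (map id (filter L? (allFin n)))    ≡⟨ cong (minor ET) (map-id (filter L? (allFin n))) ⟩
    minor ET (filter L? (allFin n))             ≡⟨ sym (charPolyOn≡minor FinP._≟_ (adj T) _ x (UP.filter⁺ L? (UP.allFin⁺ n))) ⟩
    PT L?                                       ∎
    where open ≡-Reasoning

  PT-cong : ∀ {L L′} (L? : U.Decidable L) (L′? : U.Decidable L′) → L U.≐ L′ → PT L? ≡ PT L′?
  PT-cong L? L′? L≐L′ = cong (λ vs → charPolyOn (adj T) vs x) (filter-≐ L? L′? L≐L′ (allFin n))

  minor-cut-branch : ∀ {L} (L? : U.Decidable L) i is → L (u i) → All (_≢ i) is →
                     minor E (treePart L? ++ branch i ++ branches is) ≡
                     minor E (treePart L? ++ branches is) * R ^ a i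
                     + minor E (treePart (without? FinP._≟_ L? (u i)) ++ branches is) * (+ a i * Q * R ^ (a i ℕ.∸ 1))
  minor-cut-branch L? i is Lui is≢i = begin
    minor E (treePart L? ++ branch i ++ rest)
      ≡⟨ minor-↭ E reorder ⟩
    minor E (v ∷ (treePart L′? ++ rest) ++ branch i)
      ≡⟨ minor-cut E v (treePart L′? ++ rest) (branch i) no-edges-out no-edges-in ⟩
    minor E (v ∷ treePart L′? ++ rest) * minor E (branch i)
      + minor E (treePart L′? ++ rest) * (minor E (v ∷ branch i) - E v v * minor E (branch i))
      ≡⟨ cong₂ (λ A d → A * minor E (branch i) + minor E (treePart L′? ++ rest) * (minor E (v ∷ branch i) - d * minor E (branch i)))
               (minor-↭ E (Perm.↭-sym (PermP.++⁺ʳ rest pick-u))) (E-root (u i)) ⟩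
    minor E (treePart L? ++ rest) * minor E (branch i)
      + minor E (treePart L′? ++ rest) * (minor E (v ∷ branch i) - x * minor E (branch i))
      ≡⟨ cong₂ (λ A B → minor E (treePart L? ++ rest) * A + minor E (treePart L′? ++ rest) * B)
               (minor-copies i (allFin (a i)) (UP.allFin⁺ _)) (minor-rooted-copies i (allFin (a i)) (UP.allFin⁺ _)) ⟩
    minor E (treePart L? ++ rest) * R ^ length (allFin (a i))
      + minor E (treePart L′? ++ rest) * (+ length (allFin (a i)) * Q * R ^ (length (allFin (a i)) ℕ.∸ 1))
      ≡⟨ cong (λ l → minor E (treePart L? ++ rest) * R ^ l + minor E (treePart L′? ++ rest) * (+ l * Q * R ^ (l ℕ.∸ 1)))
              (length-tabulate {n = a i} id) ⟩
    minor E (treePart L? ++ rest) * R ^ a i + minor E (treePart L′? ++ rest) * (+ a i * Q * R ^ (a i ℕ.∸ 1))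
      ∎
    where
      open ≡-Reasoning
      v    = inj₁ (u i)
      rest = branches is
      L′?  = without? FinP._≟_ L? (u i)
      pick-u : treePart L? ↭ v ∷ treePart L′?
      pick-u = PermP.map⁺ inj₁ (filter-↭-pick FinP._≟_ L? (UP.allFin⁺ n) (∈-allFin (u i)) Lui)
      reorder : treePart L? ++ branch i ++ rest ↭ v ∷ (treePart L′? ++ rest) ++ branch i
      reorder = Perm.trans (PermP.++⁺ˡ (treePart L?) (PermP.++-comm (branch i) rest))
                (Perm.trans (Perm.↭-reflexive (sym (++-assoc (treePart L?) rest (branch i))))
                            (PermP.++⁺ʳ (branch i) (PermP.++⁺ʳ rest pick-u)))
      away-from-u : All (u i ≢_) (filter L′? (allFin n))
      away-from-u = All.map (λ (_ , t≢ui) ui≡t → t≢ui (sym ui≡t)) (AllP.all-filter L′? (allFin n))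
      no-edges-out : NoEdges E (treePart L′? ++ rest) (branch i)
      no-edges-out = AllP.++⁺ (AllP.map⁺ (All.map (λ ui≢s → All-branch i (λ c w → E-tree-branch _ i c w ui≢s)) away-from-u))
                              (All-branches is (All.map (λ j≢i c′ w′ → All-branch i (λ c w → E-other-branch c′ c w′ w j≢i)) is≢i))
      no-edges-in : NoEdges E (branch i) (treePart L′? ++ rest)
      no-edges-in = All-branch i (λ c w →
        AllP.++⁺ (AllP.map⁺ (All.map (E-branch-tree _ i c w) away-from-u))
                 (All-branches is (All.map (λ j≢i c′ w′ → E-other-branch c c′ w w′ (j≢i ∘ sym)) is≢i)))

  Deleted : ∀ {l} → (Fin l → Fin k) → Subset l → Fin n → Set
  Deleted emb I t = ∃ λ j → j ∈ I × u (emb j) ≡ t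

  Deleted? : ∀ {l} (emb : Fin l → Fin k) I → U.Decidable (Deleted emb I)
  Deleted? emb I t = FinP.any? (λ j → (j ∈? I) ×-dec (u (emb j) FinP.≟ t))

  survivors? : ∀ {L : Pred (Fin n) 0ℓ} → U.Decidable L → ∀ {l} (emb : Fin l → Fin k) I → U.Decidable (λ t → L t × ¬ Deleted emb I t)
  survivors? L? emb I t = L? t ×-dec ¬? (Deleted? emb I t)

  Deleted-outside : ∀ {l} (emb : Fin (suc l) → Fin k) I {t} →
                    Deleted emb (false ∷ I) t ⇔ Deleted (emb ∘ suc) I t
  Deleted-outside emb I = mk⇔ (λ { (suc j , Vec.there j∈I , e) → j , j∈I , e })
                              (λ { (j , j∈I , e) → suc j , Vec.there j∈I , e })

  Deleted-inside : ∀ {l} (emb : Fin (suc l) → Fin k) I {t} →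
                   Deleted emb (true ∷ I) t ⇔ (u (emb zero) ≡ t ⊎ Deleted (emb ∘ suc) I t)
  Deleted-inside emb I = mk⇔ (λ { (zero , _ , e) → inj₁ e ; (suc j , Vec.there j∈I , e) → inj₂ (j , j∈I , e) })
                             [ (λ e → zero , Vec.here , e) , (λ { (j , j∈I , e) → suc j , Vec.there j∈I , e }) ]

  survivors-outside : ∀ {L : Pred (Fin n) 0ℓ} {l} (emb : Fin (suc l) → Fin k) I →
                      (λ t → L t × ¬ Deleted emb (false ∷ I) t) U.≐ (λ t → L t × ¬ Deleted (emb ∘ suc) I t)
  survivors-outside emb I = (λ (Lt , ¬D) → Lt , ¬D ∘ Equivalence.from (Deleted-outside emb I))
                          , (λ (Lt , ¬D) → Lt , ¬D ∘ Equivalence.to (Deleted-outside emb I))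

  survivors-inside : ∀ {L : Pred (Fin n) 0ℓ} {l} (emb : Fin (suc l) → Fin k) I →
                     (λ t → L t × ¬ Deleted emb (true ∷ I) t) U.≐ (λ t → (L t × t ≢ u (emb zero)) × ¬ Deleted (emb ∘ suc) I t)
  survivors-inside emb I =
      (λ (Lt , ¬D) → (Lt , ¬D ∘ Equivalence.from (Deleted-inside emb I) ∘ inj₁ ∘ sym)
                     , ¬D ∘ Equivalence.from (Deleted-inside emb I) ∘ inj₂)
    , (λ ((Lt , t≢) , ¬D) → Lt , [ t≢ ∘ sym , ¬D ] ∘ Equivalence.to (Deleted-inside emb I))

  expansion : ∀ {l} (emb : Fin l → Fin k) → Injective _≡_ _≡_ emb →
              ∀ {L : Pred (Fin n) 0ℓ} (L? : U.Decidable L) → (∀ j → L (u (emb j))) → (∀ j → 1 ≤ a (emb j)) →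
              minor E (treePart L? ++ branches (tabulate emb)) ≡
              sumℤ (map (λ I → PT (survivors? L? emb I) * weight (a ∘ emb) Q R I) (allSubsets l))
  expansion {zero} emb _ L? _ _ = begin
    minor E (treePart L? ++ [])   ≡⟨ cong (minor E) (++-identityʳ (treePart L?)) ⟩
    minor E (treePart L?)         ≡⟨ minor-treePart L? ⟩
    PT L?                         ≡⟨ PT-cong L? (survivors? L? emb []) ((λ Lt → Lt , λ { (() , _) }) , proj₁) ⟩
    PT (survivors? L? emb [])     ≡⟨ ring _ ⟩
    PT (survivors? L? emb []) * (+ 1 * + 1 * + 1) + + 0 ∎
    where open ≡-Reasoning
          ring : ∀ X → X ≡ X * (+ 1 * + 1 * + 1) + + 0
          ring = solve-∀
  expansion {suc l} emb emb-injective {L} L? L-u pos = begin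
    minor E (treePart L? ++ branch i ++ branches is)
      ≡⟨ minor-cut-branch L? i is (L-u zero) is≢i ⟩
    minor E (treePart L? ++ branches is) * R ^ a i + minor E (treePart L′? ++ branches is) * C
      ≡⟨ cong₂ (λ A B → A * R ^ a i + B * C) (expansion emb′ emb′-injective L? (L-u ∘ suc) (pos ∘ suc))
                                              (expansion emb′ emb′-injective L′? L′-u (pos ∘ suc)) ⟩
    sumℤ (map (term′ L?) S) * R ^ a i + sumℤ (map (term′ L′?) S) * C
      ≡⟨ sym (cong₂ _+_ (sum-over (false ∷_) term-outside) (sum-over (true ∷_) term-inside)) ⟩
    sumℤ (map term (map (false ∷_) S)) + sumℤ (map term (map (true ∷_) S))
      ≡⟨ sym (trans (cong sumℤ (map-++ term (map (false ∷_) S) (map (true ∷_) S)))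
                    (sumℤ-++ (map term (map (false ∷_) S)) (map term (map (true ∷_) S)))) ⟩
    sumℤ (map term (allSubsets (suc l)))
      ∎
    where
      open ≡-Reasoning
      i    = emb zero
      emb′ = emb ∘ suc
      is   = tabulate emb′
      S    = allSubsets l
      C    = + a i * Q * R ^ (a i ℕ.∸ 1)
      L′?  = without? FinP._≟_ L? (u i)
      emb′-injective : Injective _≡_ _≡_ emb′
      emb′-injective = FinP.suc-injective ∘ emb-injective
      suc≢zero : ∀ j → emb′ j ≢ i
      suc≢zero j e with () ← emb-injective e
      is≢i : All (_≢ i) is
      is≢i = AllP.tabulate⁺ suc≢zero
      L′-u : ∀ j → L (u (emb′ j)) × u (emb′ j) ≢ u i
      L′-u j = L-u (suc j) , suc≢zero j ∘ u-injective
      term : Subset (suc l) → ℤ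
      term I = PT (survivors? L? emb I) * weight (a ∘ emb) Q R I
      term′ : ∀ {L′ : Pred (Fin n) 0ℓ} → U.Decidable L′ → Subset l → ℤ
      term′ L″? I = PT (survivors? L″? emb′ I) * weight (a ∘ emb′) Q R I
      term-outside : ∀ I → term (false ∷ I) ≡ term′ L? I * R ^ a i
      term-outside I = trans (cong₂ _*_ (PT-cong (survivors? L? emb (false ∷ I)) (survivors? L? emb′ I) (survivors-outside emb I))
                                        (weight-outside (a ∘ emb) Q R (pos ∘ suc) I))
                             (sym (ℤP.*-assoc (PT (survivors? L? emb′ I)) (weight (a ∘ emb′) Q R I) (R ^ a i)))
      term-inside : ∀ I → term (true ∷ I) ≡ term′ L′? I * C
      term-inside I = trans (cong₂ _*_ (PT-cong (survivors? L? emb (true ∷ I)) (survivors? L′? emb′ I) (survivors-inside emb I))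
                                       (weight-inside (a ∘ emb) Q R pos I))
                            (sym (ℤP.*-assoc (PT (survivors? L′? emb′ I)) (weight (a ∘ emb′) Q R I) C))
      sum-over : ∀ (f : Subset l → Subset (suc l)) {g : Subset l → ℤ} {c} → (∀ I → term (f I) ≡ g I * c) →
                 sumℤ (map term (map f S)) ≡ sumℤ (map g S) * c
      sum-over f {g} {c} h = trans (cong sumℤ (trans (sym (map-∘ S)) (map-cong h S))) (sumℤ-*ʳ g c S)

  unique-copies : ∀ i cs → Unique cs → Unique (copies i cs)
  unique-copies i []       _            = []
  unique-copies i (c ∷ cs) (c∉cs ∷ us) =
    AllPairsP.++⁺ (UP.map⁺ (λ { refl → refl }) (UP.allFin⁺ m)) (unique-copies i cs us)
                  (All-copy i c (λ w → All-copies i cs (All.map (λ c≢c′ w′ → λ { refl → c≢c′ refl }) c∉cs)))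

  unique-branches : ∀ is → Unique is → Unique (branches is)
  unique-branches []       _            = []
  unique-branches (i ∷ is) (i∉is ∷ us) =
    AllPairsP.++⁺ (unique-copies i (allFin (a i)) (UP.allFin⁺ _)) (unique-branches is us)
                  (All-branch i (λ c w → All-branches is (All.map (λ i≢j c′ w′ → λ { refl → i≢j refl }) i∉is)))

  unique-vertices : Unique (coalVertices n k a m)
  unique-vertices = AllPairsP.++⁺ (UP.map⁺ (λ { refl → refl }) (UP.allFin⁺ n)) (unique-branches (allFin k) (UP.allFin⁺ k))
                                  (AllP.map⁺ (All.universal (λ s → All-branches (allFin k) (All.universal (λ j c w → λ ()) _)) _))

  theorem : (∀ i → 1 ≤ a i) → PCoal T u a G r x ≡ RHS T u a G r x
  theorem pos = begin
    PCoal T u a G r x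
      ≡⟨ charPolyOn≡minor _≟V_ (coalAdj T u a G r) (coalVertices n k a m) x unique-vertices ⟩
    minor E (map inj₁ (allFin n) ++ branches (allFin k))
      ≡⟨ cong (λ vs → minor E (map inj₁ vs ++ branches (allFin k))) (sym (filter-all U? (All.universal _ (allFin n)))) ⟩
    minor E (treePart U? ++ branches (tabulate id))
      ≡⟨ expansion id id U? _ pos ⟩
    sumℤ (map (λ I → PT (survivors? U? id I) * weight a Q R I) (allSubsets k))
      ≡⟨ cong sumℤ (map-cong rhs-term (allSubsets k)) ⟩
    RHS T u a G r x
      ∎
    where
      open ≡-Reasoning
      rhs-term : ∀ I → PT (survivors? U? id I) * weight a Q R I
                       ≡ PminusSet T u I x * + prodIn a I * Q ^ ∣ I ∣ * R ^ (sumAll a ℕ.∸ ∣ I ∣)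
      rhs-term I = trans (cong (_* weight a Q R I) (PT-cong (survivors? U? id I) (¬? ∘ Deleted? id I) (proj₂ , (_ ,_))))
                         (ring (PminusSet T u I x) (+ prodIn a I) (Q ^ ∣ I ∣) (R ^ (sumAll a ℕ.∸ ∣ I ∣)))
        where ring : ∀ X p q s → X * (p * q * s) ≡ X * p * q * s
              ring = solve-∀

corollary1 : (n : ℕ) (T : Graph n) (k : ℕ) → 1 ≤ k →
    (u : Fin k → Fin n) → Injective _≡_ _≡_ u →
    (m : ℕ) (G : Graph (suc m)) (r : Fin (suc m)) →
    (a : Fin k → ℕ) → (∀ i → 1 ≤ a i) →
    (x : ℤ) → PCoal T u a G r x ≡ RHS T u a G r x
corollary1 n T k _ u u-injective m G r a pos x = Coalescence.theorem T u u-injective G r a x pos
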